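{- Given an interpretation of types, let $\rho$ be a type and $i\le i'$ with $i,i'\in I_\rho$. 1. If $\rho$ is positive, then the factor system $(\llbracket\rho\rrbracket_i)_{i\in I_\rho}$ is direct and, for $a\in\llbracket\rho\rrbracket$ and $a_i\in\llbracket\rho\rrbracket_i$, $a\rhd a_i$ implies $a\rhd\mathrm{emb}_{i,i'}(a_i)$. 2. If $\rho$ is negative, then the factor system is inverse and, for $a\in\llbracket\rho\rrbracket$ and $a_{i'}\in\llbracket\rho\rrbracket_{i'}$, $a\rhd a_{i'}$ implies $a\rhd\mathrm{proj}_{i',i}(a_{i'})$.
   Context: Factor systems: over a nonempty directed preorder $I$, sets $M_i$ with relations $\rhd\subseteq M_{i'}\times M_i$ ($i\le i'$, reflexive for $i=i'$); $a_i\approx b_j$ iff some $a_{i'}$ ($i'\ge i,j$) has $a_{i'}\rhd a_i$, $a_{i'}\rhd b_j$; prefactor: $a_{i'}\approx a_i\iff a_{i'}\rhd a_i$; factor system: prefactor system with $\approx$-preserving $\mathrm{emb}_{i,i'}:M_i\to M_{i'}$, $\mathrm{proj}_{i',i}:M_{i'}\to M_i$ with $\mathrm{emb}_{i,i}(a)\approx a\approx\mathrm{proj}_{i,i}(a)$, composition laws up to $\approx$, $\mathrm{proj}_{i',i}\circ\mathrm{emb}_{i,i'}(a)\approx a$, and coherence $a_{i'}\rhd a_i\Rightarrow\mathrm{emb}_{i',i''}(a_{i'})\rhd a_i$, $a_{i''}\rhd a_i\Rightarrow\mathrm{proj}_{i'',i'}(a_{i''})\rhd a_i$. Direct: $a_{i'}\rhd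 a_i\iff a_{i'}\approx\mathrm{emb}_{i,i'}(a_i)$; inverse: $a_{i'}\rhd a_i\iff\mathrm{proj}_{i',i}(a_{i'})\approx a_i$. Function space $[M_I\to N_J]$: index $I\times J$ (product order, written $i\to j$), $\approx$-preserving maps $M_i\to N_j$, $f'\rhd f$ iff ($a_{i'}\rhd a_i\Rightarrow f'(a_{i'})\rhd f(a_i)$), $\mathrm{emb}(f)=\mathrm{emb}_{j,j'}\circ f\circ\mathrm{proj}_{i',i}$, $\mathrm{proj}(f')=\mathrm{proj}_{j',j}\circ f'\circ\mathrm{emb}_{i,i'}$. A filter assignment $\mathcal F(I)$: cofinal subsets of $I$, closed under supersets and finite intersections, containing all up-sets; Condition (D): $H\in\mathcal F(I\times J)$, $I'\in\mathcal F(I)$ imply $\{j\mid\exists i\in I',\ i\to j\in H\}\in\mathcal F(J)$; assumed throughout. A target/limit of a factor system: a set $M$ with a relation $a\rhd a_i$ such that $\{i\mid\exists a_i,\ a\rhd a_i\}\in\mathcal F(I)$, $a\rhd a_{i'},a\rhd a_i,i\le i'\Rightarrow a_{i'}\rhd a_i$; a limit is moreover maximal (every $\{a_i\mid a\rhd a_i\}$ is an inclusion-maximal consistent set, a consistent set being $\alpha\subseteq\bigcup M_i$ with $a_{i'}\rhd a_i$ for all its elements with $i\le i'$ and occupied index set in $\mathcal F(I)$), extensional and complete. Types: $\rho::=\iota\mid\rho\to\rho$ with base types $\iota$, including $\mathrm{prop}$. Positive types: $\rho^+::=\iota\mid\rho^-\to\rho^+$; negative types: $\rho^-::=\mathrm{prop}\mid\rho^+\to\rho^-$.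 Each type $\rho$ has an index set $I_\rho$, with $I_{\rho\to\sigma}=I_\rho\times I_\sigma$ and $I_{\mathrm{prop}}=\{\mathrm{prop}\}$. An interpretation of types assigns to each type $\rho$ a factor system $(\llbracket\rho\rrbracket_i)_{i\in I_\rho}$ and a limit $\llbracket\rho\rrbracket$ of it such that: for base types $\iota$ the factor system is direct; $\mathrm{prop}$ is interpreted by the one-index factor system $\llbracket\mathrm{prop}\rrbracket_{\mathrm{prop}}=\{true,false\}$ (with $\rhd$ equality) with limit $\{true,false\}$; $\rho\to\sigma$ is interpreted by the function space factor system $[(\llbracket\rho\rrbracket_i)\to(\llbracket\sigma\rrbracket_j)]$ with limit $[\llbracket\rho\rrbracket\to_{\mathcal F}\llbracket\sigma\rrbracket]$, the set of $f:\llbracket\rho\rrbracket\to\llbracket\sigma\rrbracket$ with $\{i\to j\mid\exists f_{i\to j},\ f\rhd f_{i\to j}\}\in\mathcal F(I_\rho\times I_\sigma)$, where $f\rhd f_{i\to j}$ iff $a\rhd a_i$ implies $f(a)\rhd f_{i\to j}(a_i)$. -}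

module Defs where

open import Level using (Lift; lift)
open import Data.Product using (Σ; Σ-syntax; ∃; ∃-syntax; _×_; _,_; proj₁; proj₂)
open import Data.Unit using (⊤; tt)
open import Data.Bool using (Bool)
open import Relation.Binary.PropositionalEquality using (_≡_)

_iff_ : Set → Set → Set
A iff B = (A → B) × (B → A)

-- Nonempty directed preorders (the order relation is proof-irrelevant,
-- i.e. a genuine relation)

record DirPreorder : Set₁ where
  field
    Carrier      : Set
    _≤_          : Carrier → Carrier → Set
    ≤-irrelevant : ∀ {i j} (p q : i ≤ j) → p ≡ q
    ≤-refl       : ∀ {i} → i ≤ i
    ≤-trans      : ∀ {i j k} → i ≤ j → j ≤ k → i ≤ k
    inhabitant   : Carrier
    directed     : ∀ i j → ∃[ k ] (i ≤ k × j ≤ k)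

open DirPreorder public using () renaming (Carrier to ∣_∣)

-- product order (an index (i , j) of I × J is written i → j in the paper)
_×ᴾ_ : DirPreorder → DirPreorder → DirPreorder
I ×ᴾ J = record
  { Carrier      = ∣ I ∣ × ∣ J ∣
  ; _≤_          = λ k k' → (proj₁ k ≤I proj₁ k') × (proj₂ k ≤J proj₂ k')
  ; ≤-irrelevant = λ p q → pairEq (DirPreorder.≤-irrelevant I (proj₁ p) (proj₁ q))
                                   (DirPreorder.≤-irrelevant J (proj₂ p) (proj₂ q))
  ; ≤-refl       = DirPreorder.≤-refl I , DirPreorder.≤-refl J
  ; ≤-trans      = λ p q → DirPreorder.≤-trans I (proj₁ p) (proj₁ q)
                         , DirPreorder.≤-trans J (proj₂ p) (proj₂ q)
  ; inhabitant   = DirPreorder.inhabitant I , DirPreorder.inhabitant J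
  ; directed     = λ k k' → dir k k'
  }
  where
  open DirPreorder I using () renaming (_≤_ to _≤I_)
  open DirPreorder J using () renaming (_≤_ to _≤J_)
  open import Relation.Binary.PropositionalEquality using (refl)
  pairEq : ∀ {A B : Set} {a a' : A} {b b' : B} → a ≡ a' → b ≡ b' → (a , b) ≡ (a' , b')
  pairEq refl refl = refl
  dir : ∀ (k k' : ∣ I ∣ × ∣ J ∣) → ∃[ m ] (((proj₁ k ≤I proj₁ m) × (proj₂ k ≤J proj₂ m))
                                                  × ((proj₁ k' ≤I proj₁ m) × (proj₂ k' ≤J proj₂ m)))
  dir (i , j) (i' , j') with DirPreorder.directed I i i' | DirPreorder.directed J j j'
  ... | (a , p , p') | (b , q , q') = (a , b) , (p , q) , (p' , q')

unitᴾ : DirPreorder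
unitᴾ = record
  { Carrier = ⊤ ; _≤_ = λ _ _ → ⊤ ; ≤-irrelevant = λ _ _ → refl' ; ≤-refl = tt
  ; ≤-trans = λ _ _ → tt ; inhabitant = tt ; directed = λ _ _ → tt , tt , tt }
  where
  open import Relation.Binary.PropositionalEquality using (refl)
  refl' : tt ≡ tt
  refl' = refl

Subset : DirPreorder → Set₁
Subset I = ∣ I ∣ → Set

Cofinal : (I : DirPreorder) → Subset I → Set
Cofinal I S = ∀ i → ∃[ k ] (i ≤ k × S k)
  where open DirPreorder I

record FilterAssignment : Set₁ where
  field
    𝓕        : (I : DirPreorder) → Subset I → Set
    cofinal  : ∀ I S → 𝓕 I S → Cofinal I S
    superset : ∀ I (S T : Subset I) → (∀ i → S i → T i) → 𝓕 I S → 𝓕 I T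
    inter    : ∀ I (S T : Subset I) → 𝓕 I S → 𝓕 I T → 𝓕 I (λ i → S i × T i)
    up-sets  : ∀ I i → 𝓕 I (λ k → DirPreorder._≤_ I i k)
    condD    : ∀ I J (H : Subset (I ×ᴾ J)) (I' : Subset I) →
               𝓕 (I ×ᴾ J) H → 𝓕 I I' →
               𝓕 J (λ j → ∃[ i ] (I' i × H (i , j)))

-- raw data: sets M_i, relations ▷ (rel i' i a' a  means  a' ▷ a, for a' ∈ M_i',
-- a ∈ M_i; only relevant for i ≤ i'), embeddings and projections
record FSData (I : DirPreorder) : Set₁ where
  open DirPreorder I
  field
    M    : Carrier → Set
    rel  : ∀ i' i → M i' → M i → Set
    emb  : ∀ {i i'} → i ≤ i' → M i → M i'
    proj : ∀ {i i'} → i ≤ i' → M i' → M i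

  Approx : ∀ i j → M i → M j → Set
  Approx i j a b = ∃[ k ] (i ≤ k × j ≤ k × Σ (M k) λ c → rel k i c a × rel k j c b)

record IsFactorSystem {I : DirPreorder} (D : FSData I) : Set where
  open DirPreorder I
  open FSData D
  field
    ▷-refl    : ∀ i (a : M i) → rel i i a a
    prefactor : ∀ i i' → i ≤ i' → (a' : M i') (a : M i) → Approx i' i a' a iff rel i' i a' a
    emb-pres  : ∀ i i' (p : i ≤ i') (a b : M i) → Approx i i a b → Approx i' i' (emb p a) (emb p b)
    proj-pres : ∀ i i' (p : i ≤ i') (a b : M i') → Approx i' i' a b → Approx i i (proj p a) (proj p b)
    emb-id    : ∀ i (p : i ≤ i) (a : M i) → Approx i i (emb p a) a
    proj-id   : ∀ i (p : i ≤ i) (a : M i) → Approx i i a (proj p a)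
    emb-comp  : ∀ i i' i'' (p : i ≤ i') (q : i' ≤ i'') (r : i ≤ i'') (a : M i) →
                Approx i'' i'' (emb q (emb p a)) (emb r a)
    proj-comp : ∀ i i' i'' (p : i ≤ i') (q : i' ≤ i'') (r : i ≤ i'') (a : M i'') →
                Approx i i (proj p (proj q a)) (proj r a)
    proj-emb  : ∀ i i' (p : i ≤ i') (a : M i) → Approx i i (proj p (emb p a)) a
    coh-emb   : ∀ i i' i'' → i ≤ i' → (q : i' ≤ i'') (a' : M i') (a : M i) →
                rel i' i a' a → rel i'' i (emb q a') a
    coh-proj  : ∀ i i' i'' → i ≤ i' → (q : i' ≤ i'') (a'' : M i'') (a : M i) →
                rel i'' i a'' a → rel i' i (proj q a'') a

record FactorSystem (I : DirPreorder) : Set₁ where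
  field
    dat  : FSData I
    laws : IsFactorSystem dat
  open FSData dat public

IsDirect : {I : DirPreorder} → FSData I → Set
IsDirect {I} D = ∀ i i' (p : i ≤ i') (a' : M i') (a : M i) → rel i' i a' a iff Approx i' i' a' (emb p a)
  where open DirPreorder I
        open FSData D

IsInverse : {I : DirPreorder} → FSData I → Set
IsInverse {I} D = ∀ i i' (p : i ≤ i') (a' : M i') (a : M i) → rel i' i a' a iff Approx i i (proj p a') a
  where open DirPreorder I
        open FSData D

FunSpace : {I J : DirPreorder} → FactorSystem I → FactorSystem J → FSData (I ×ᴾ J)
FunSpace {I} {J} A B = record
  { M    = λ k → Σ (A.M (proj₁ k) → B.M (proj₂ k)) λ f →
                 ∀ a b → A.Approx (proj₁ k) (proj₁ k) a b → B.Approx (proj₂ k) (proj₂ k) (f a) (f b)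
  ; rel  = λ k' k f' f → ∀ a' a → A.rel (proj₁ k') (proj₁ k) a' a →
                         B.rel (proj₂ k') (proj₂ k) (proj₁ f' a') (proj₁ f a)
  ; emb  = λ {k} {k'} pq f →
             (λ a' → B.emb (proj₂ pq) (proj₁ f (A.proj (proj₁ pq) a')))
           , λ a b e → IsFactorSystem.emb-pres B.laws _ _ (proj₂ pq) _ _
                         (proj₂ f _ _ (IsFactorSystem.proj-pres A.laws _ _ (proj₁ pq) a b e))
  ; proj = λ {k} {k'} pq f' →
             (λ a → B.proj (proj₂ pq) (proj₁ f' (A.emb (proj₁ pq) a)))
           , λ a b e → IsFactorSystem.proj-pres B.laws _ _ (proj₂ pq) _ _
                         (proj₂ f' _ _ (IsFactorSystem.emb-pres A.laws _ _ (proj₁ pq) a b e))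
  }
  where module A = FactorSystem A
        module B = FactorSystem B

-- a set M with a relation a ▷ a_i  (lrel i a aᵢ)
record TData {I : DirPreorder} (D : FSData I) : Set₁ where
  field
    L    : Set
    lrel : ∀ i → L → FSData.M D i → Set

module _ (Φ : FilterAssignment) {I : DirPreorder} (D : FSData I) where
  open FilterAssignment Φ
  open DirPreorder I
  open FSData D

  record IsTarget (T : TData D) : Set where
    open TData T
    field
      occupied   : ∀ a → 𝓕 I (λ i → Σ (M i) λ aᵢ → lrel i a aᵢ)
      compatible : ∀ a i i' → i ≤ i' → (a' : M i') (aᵢ : M i) →
                   lrel i' a a' → lrel i a aᵢ → rel i' i a' aᵢ

  IsConsistent : (α : ∀ i → M i → Set) → Set
  IsConsistent α = (∀ i i' → i ≤ i' → (a' : M i') (a : M i) → α i' a' → α i a → rel i' i a' a)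
                 × 𝓕 I (λ i → Σ (M i) (α i))

  IsMaximalConsistent : (α : ∀ i → M i → Set) → Set₁
  IsMaximalConsistent α = IsConsistent α ×
    (∀ (β : ∀ i → M i → Set) → IsConsistent β → (∀ i a → α i a → β i a) → ∀ i a → β i a → α i a)

  record IsLimit (T : TData D) : Set₁ where
    open TData T
    field
      target  : IsTarget T
      maximal : ∀ a → IsMaximalConsistent (λ i aᵢ → lrel i a aᵢ)

FunT : (Φ : FilterAssignment) {I J : DirPreorder} (A : FactorSystem I) (B : FactorSystem J) →
       TData (FactorSystem.dat A) → TData (FactorSystem.dat B) → TData (FunSpace A B)
FunT Φ {I} {J} A B TA TB = record
  { L    = Σ (TA.L → TB.L) λ f → 𝓕 (I ×ᴾ J) (λ k → Σ (FSData.M (FunSpace A B) k) λ fk → frel k f fk)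
  ; lrel = λ k f fk → frel k (proj₁ f) fk
  }
  where
  open FilterAssignment Φ
  module TA = TData TA
  module TB = TData TB
  frel : ∀ k → (TA.L → TB.L) → FSData.M (FunSpace A B) k → Set
  frel k f fk = ∀ a aᵢ → TA.lrel (proj₁ k) a aᵢ → TB.lrel (proj₂ k) (f a) (proj₁ fk aᵢ)

propData : FSData unitᴾ
propData = record { M = λ _ → Bool ; rel = λ _ _ a b → a ≡ b ; emb = λ _ a → a ; proj = λ _ a → a }

propT : TData propData
propT = record { L = Bool ; lrel = λ _ a b → a ≡ b }

data Ty (B : Set) : Set where
  prop : Ty B
  base : B → Ty B
  _⇒_  : Ty B → Ty B → Ty B

infixr 5 _⇒_

mutual
  data Pos {B : Set} : Ty B → Set where
    pos-prop : Pos prop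
    pos-base : ∀ b → Pos (base b)
    pos-⇒    : ∀ {ρ σ} → Neg ρ → Pos σ → Pos (ρ ⇒ σ)

  data Neg {B : Set} : Ty B → Set where
    neg-prop : Neg prop
    neg-⇒    : ∀ {ρ σ} → Pos ρ → Neg σ → Neg (ρ ⇒ σ)

module _ (B : Set) (Φ : FilterAssignment) where

  record BaseInterp : Set₁ where
    field
      idx    : B → DirPreorder
      fs     : ∀ b → FactorSystem (idx b)
      direct : ∀ b → IsDirect (FactorSystem.dat (fs b))
      limT   : ∀ b → TData (FactorSystem.dat (fs b))
      lim    : ∀ b → IsLimit Φ (FactorSystem.dat (fs b)) (limT b)

  module Sem (β : BaseInterp) where
    open BaseInterp β

    Idx : Ty B → DirPreorder
    Idx prop     = unitᴾ
    Idx (base b) = idx b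
    Idx (ρ ⇒ σ)  = Idx ρ ×ᴾ Idx σ

    -- Str ρ : the proofs that the structures assigned to ρ (and its subtypes)
    -- are factor systems and limits
    Str   : Ty B → Set₁
    semFS : (ρ : Ty B) → Str ρ → FactorSystem (Idx ρ)
    semT  : (ρ : Ty B) (s : Str ρ) → TData (FactorSystem.dat (semFS ρ s))

    Str prop     = IsFactorSystem propData × IsLimit Φ propData propT
    Str (base b) = Lift _ ⊤
    Str (ρ ⇒ σ)  = Σ (Str ρ) λ s → Σ (Str σ) λ t →
                   Σ (IsFactorSystem (FunSpace (semFS ρ s) (semFS σ t))) λ _ →
                   IsLimit Φ (FunSpace (semFS ρ s) (semFS σ t))
                             (FunT Φ (semFS ρ s) (semFS σ t) (semT ρ s) (semT σ t))

    semFS prop s            = record { dat = propData ; laws = proj₁ s }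
    semFS (base b) _        = fs b
    semFS (ρ ⇒ σ) (s , t , l , _) = record { dat = FunSpace (semFS ρ s) (semFS σ t) ; laws = l }

    semT prop _             = propT
    semT (base b) _         = limT b
    semT (ρ ⇒ σ) (s , t , _ , _) = FunT Φ (semFS ρ s) (semFS σ t) (semT ρ s) (semT σ t)

  record Interp : Set₁ where
    field
      baseI    : BaseInterp
    open Sem baseI
    field
      str      : ∀ ρ → Str ρ
      coherent : ∀ ρ σ → proj₁ (str (ρ ⇒ σ)) ≡ str ρ × proj₁ (proj₂ (str (ρ ⇒ σ))) ≡ str σ

    Index : Ty B → DirPreorder
    Index = Idx

    ⟦_⟧fs : (ρ : Ty B) → FactorSystem (Idx ρ)
    ⟦ ρ ⟧fs = semFS ρ (str ρ)

    ⟦_⟧ : (ρ : Ty B) → TData (FactorSystem.dat ⟦ ρ ⟧fs)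
    ⟦ ρ ⟧ = semT ρ (str ρ)

{-# OPTIONS --safe #-}
-- By prefactoriality ▷ on a single index is an equivalence ≈, and directness (inverseness)
-- says that a' ▷ a iff a' ≈ emb a (proj a' ≈ a). For [A → B] with A inverse and B direct,
-- f' ▷ f unfolds to a statement about f' a' and f (proj a'), which directness of B turns into
-- f' ≈ emb f = emb ∘ f ∘ proj; dually with the roles of emb and proj exchanged. The same
-- unfolding carries closure of limit components under proj on A and under emb on B to closure
-- under emb on [A → B]. At base types, where only directness is given, closure under emb
-- comes from maximality: emb aᵢ is ▷-compatible with every component of a, as one sees by
-- projecting a component far above to the index of emb aᵢ.
module Submission where

open import Defs
open import Data.Product using (Σ; _×_; _,_; proj₁; proj₂; swap)
open import Data.Sum using (inj₁; inj₂; _⊎_)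
open import Function using (_∘_)
open import Relation.Binary.PropositionalEquality using (_≡_; refl)

module Equivalence {I : DirPreorder} (F : FactorSystem I) where
  open DirPreorder I
  open FactorSystem F
  open IsFactorSystem laws

  _≈_ : ∀ {i} → M i → M i → Set
  _≈_ {i} = rel i i

  Approx⇒≈ : ∀ {i} {a b : M i} → Approx i i a b → a ≈ b
  Approx⇒≈ = proj₁ (prefactor _ _ ≤-refl _ _)

  ≈⇒Approx : ∀ {i} {a b : M i} → a ≈ b → Approx i i a b
  ≈⇒Approx = proj₂ (prefactor _ _ ≤-refl _ _)

  ≈-refl : ∀ {i} {a : M i} → a ≈ a
  ≈-refl = ▷-refl _ _

  ≈-sym : ∀ {i} {a b : M i} → a ≈ b → b ≈ a
  ≈-sym a≈b with ≈⇒Approx a≈b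
  ... | k , ik , ik' , c , c▷a , c▷b = Approx⇒≈ (k , ik' , ik , c , c▷b , c▷a)

  ≈-trans : ∀ {i} {a b c : M i} → a ≈ b → b ≈ c → a ≈ c
  ≈-trans {i} {b = b} a≈b b≈c = Approx⇒≈ (i , ≤-refl , ≤-refl , b , ≈-sym a≈b , b≈c)

  emb-cong : ∀ {i i'} (p : i ≤ i') {a b : M i} → a ≈ b → emb p a ≈ emb p b
  emb-cong p = Approx⇒≈ ∘ emb-pres _ _ p _ _ ∘ ≈⇒Approx

  proj-cong : ∀ {i i'} (p : i ≤ i') {a b : M i'} → a ≈ b → proj p a ≈ proj p b
  proj-cong p = Approx⇒≈ ∘ proj-pres _ _ p _ _ ∘ ≈⇒Approx

  module Direct (direct : IsDirect dat) where
    ▷⇒≈emb : ∀ {i i'} (p : i ≤ i') {a' : M i'} {a : M i} → rel i' i a' a → a' ≈ emb p a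
    ▷⇒≈emb p = Approx⇒≈ ∘ proj₁ (direct _ _ p _ _)

    ≈emb⇒▷ : ∀ {i i'} (p : i ≤ i') {a' : M i'} {a : M i} → a' ≈ emb p a → rel i' i a' a
    ≈emb⇒▷ p = proj₂ (direct _ _ p _ _) ∘ ≈⇒Approx

  module Inverse (inverse : IsInverse dat) where
    ▷⇒proj≈ : ∀ {i i'} (p : i ≤ i') {a' : M i'} {a : M i} → rel i' i a' a → proj p a' ≈ a
    ▷⇒proj≈ p = Approx⇒≈ ∘ proj₁ (inverse _ _ p _ _)

    proj≈⇒▷ : ∀ {i i'} (p : i ≤ i') {a' : M i'} {a : M i} → proj p a' ≈ a → rel i' i a' a
    proj≈⇒▷ p = proj₂ (inverse _ _ p _ _) ∘ ≈⇒Approx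

module _ {I : DirPreorder} {D : FSData I} where
  open DirPreorder I
  open FSData D

  EmbClosed : TData D → Set
  EmbClosed T = ∀ i i' (p : i ≤ i') a (aᵢ : M i) → lrel i a aᵢ → lrel i' a (emb p aᵢ)
    where open TData T

  ProjClosed : TData D → Set
  ProjClosed T = ∀ i i' (p : i ≤ i') a (aᵢ' : M i') → lrel i' a aᵢ' → lrel i a (proj p aᵢ')
    where open TData T

module Limit (Φ : FilterAssignment) {I : DirPreorder} (F : FactorSystem I)
             {T : TData (FactorSystem.dat F)} (limit : IsLimit Φ (FactorSystem.dat F) T) where
  open FilterAssignment Φ
  open DirPreorder I
  open FactorSystem F
  open IsFactorSystem laws
  open TData T
  open IsLimit limit
  open IsTarget target

  compatible⇒component : ∀ a {k} (x : M k) →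
                         (∀ {j} → j ≤ k → ∀ y → lrel j a y → rel k j x y) →
                         (∀ {j'} → k ≤ j' → ∀ y' → lrel j' a y' → rel j' k y' x) →
                         lrel k a x
  compatible⇒component a {k} x below above =
    proj₂ (maximal a) α⁺ consistent (λ _ _ → inj₁) k x (inj₂ refl)
    where
    α⁺ : ∀ j → M j → Set
    α⁺ j y = lrel j a y ⊎ _≡_ {A = Σ ∣ I ∣ M} (j , y) (k , x)

    pairwise : ∀ j j' → j ≤ j' → (y' : M j') (y : M j) → α⁺ j' y' → α⁺ j y → rel j' j y' y
    pairwise j j' le y' y (inj₁ u)    (inj₁ v)    = compatible a j j' le y' y u v
    pairwise j _  le _  y (inj₂ refl) (inj₁ v)    = below le y v
    pairwise _ j' le y' _ (inj₁ u)    (inj₂ refl) = above le y' u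
    pairwise _ _  _  _  _ (inj₂ refl) (inj₂ refl) = ▷-refl k x

    consistent : IsConsistent Φ dat α⁺
    consistent = pairwise , superset I _ _ (λ _ (y , u) → y , inj₁ u) (occupied a)

  direct⇒embClosed : IsDirect dat → EmbClosed T
  direct⇒embClosed direct i i' p a aᵢ a▷aᵢ = compatible⇒component a (emb p aᵢ) below above
    where
    open Equivalence F
    open Direct direct

    -- Some component c of a lies above i'; its projection to i' lies over both aᵢ and y.
    below : ∀ {j} → j ≤ i' → ∀ y → lrel j a y → rel i' j (emb p aᵢ) y
    below {j} j≤i' y a▷y with cofinal I _ (occupied a) i'
    ... | k , i'≤k , c , a▷c =
      ≈emb⇒▷ j≤i' (≈-trans (≈-sym (over p aᵢ a▷aᵢ)) (over j≤i' y a▷y))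
      where
      over : ∀ {l} (l≤i' : l ≤ i') (z : M l) → lrel l a z → proj i'≤k c ≈ emb l≤i' z
      over {l} l≤i' z a▷z = ▷⇒≈emb l≤i' (coh-proj l i' k l≤i' i'≤k c z
                              (compatible a l k (≤-trans l≤i' i'≤k) c z a▷c a▷z))

    above : ∀ {j'} → i' ≤ j' → ∀ y' → lrel j' a y' → rel j' i' y' (emb p aᵢ)
    above {j'} i'≤j' y' a▷y' = ≈emb⇒▷ i'≤j' (≈-trans
      (▷⇒≈emb i≤j' (compatible a i j' i≤j' y' aᵢ a▷y' a▷aᵢ))
      (≈-sym (Approx⇒≈ (emb-comp i i' j' p i'≤j' i≤j' aᵢ))))
      where
      i≤j' : i ≤ j'
      i≤j' = ≤-trans p i'≤j'

module FunctionSpace {I J : DirPreorder} (A : FactorSystem I) (B : FactorSystem J) where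
  private
    module A = FactorSystem A
    module B = FactorSystem B
    module A≈ = Equivalence A
    module B≈ = Equivalence B
    open FSData (FunSpace A B)

  cong : ∀ {k} (f : M k) {a b : A.M (proj₁ k)} → a A≈.≈ b → proj₁ f a B≈.≈ proj₁ f b
  cong f = B≈.Approx⇒≈ ∘ proj₂ f _ _ ∘ A≈.≈⇒Approx

  module _ (laws : IsFactorSystem (FunSpace A B)) where
    private
      F : FactorSystem (I ×ᴾ J)
      F = record { dat = FunSpace A B ; laws = laws }
      open Equivalence F

    FunSpace-direct : IsInverse A.dat → IsDirect B.dat → IsDirect (FunSpace A B)
    FunSpace-direct inverse direct (i , j) (i' , j') (p , q) f' f =
      ≈⇒Approx {i' , j'} {f'} {emb (p , q) f} ∘ to , from ∘ Approx⇒≈ {i' , j'} {f'} {emb (p , q) f}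
      where
      open A≈.Inverse inverse
      open B≈.Direct direct

      to : rel (i' , j') (i , j) f' f → _≈_ {i' , j'} f' (emb (p , q) f)
      to f'▷f a' b' a'≈b' = ▷⇒≈emb q (f'▷f a' (A.proj p b') (proj≈⇒▷ p (A≈.proj-cong p a'≈b')))

      from : _≈_ {i' , j'} f' (emb (p , q) f) → rel (i' , j') (i , j) f' f
      from f'≈ef a' a a'▷a = ≈emb⇒▷ q (B≈.≈-trans (f'≈ef a' a' A≈.≈-refl)
                                        (B≈.emb-cong q (cong f (▷⇒proj≈ p a'▷a))))

    FunSpace-inverse : IsDirect A.dat → IsInverse B.dat → IsInverse (FunSpace A B)
    FunSpace-inverse direct inverse (i , j) (i' , j') (p , q) f' f =
      ≈⇒Approx {i , j} {proj (p , q) f'} {f} ∘ to , from ∘ Approx⇒≈ {i , j} {proj (p , q) f'} {f}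
      where
      open A≈.Direct direct
      open B≈.Inverse inverse

      to : rel (i' , j') (i , j) f' f → _≈_ {i , j} (proj (p , q) f') f
      to f'▷f a b a≈b = ▷⇒proj≈ q (f'▷f (A.emb p a) b (≈emb⇒▷ p (A≈.emb-cong p a≈b)))

      from : _≈_ {i , j} (proj (p , q) f') f → rel (i' , j') (i , j) f' f
      from pf'≈f a' a a'▷a = proj≈⇒▷ q (B≈.≈-trans
                                         (B≈.proj-cong q (cong f' (▷⇒≈emb p a'▷a)))
                                         (pf'≈f a a A≈.≈-refl))

  module _ (Φ : FilterAssignment) {TA : TData A.dat} {TB : TData B.dat} where
    FunT-embClosed : ProjClosed TA → EmbClosed TB → EmbClosed (FunT Φ A B TA TB)
    FunT-embClosed projClosed embClosed (i , j) (i' , j') (p , q) f fₖ f▷fₖ a aᵢ' a▷aᵢ' =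
      embClosed j j' q _ _ (f▷fₖ a _ (projClosed i i' p a aᵢ' a▷aᵢ'))

    FunT-projClosed : EmbClosed TA → ProjClosed TB → ProjClosed (FunT Φ A B TA TB)
    FunT-projClosed embClosed projClosed (i , j) (i' , j') (p , q) f fₖ' f▷fₖ' a aᵢ a▷aᵢ =
      projClosed j j' q _ _ (f▷fₖ' a _ (embClosed i i' p a aᵢ a▷aᵢ))

module Polarity {B : Set} (Φ : FilterAssignment) (β : BaseInterp B Φ) where
  open Sem B Φ β
  open BaseInterp β
  open FunctionSpace

  prop-direct : IsFactorSystem propData → IsDirect propData
  prop-direct laws i i' p a' a = swap (IsFactorSystem.prefactor laws i i' p a' a)

  prop-inverse : IsFactorSystem propData → IsInverse propData
  prop-inverse laws i i' p a' a = swap (IsFactorSystem.prefactor laws i i' p a' a)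

  mutual
    positive : ∀ {ρ} → Pos ρ → (s : Str ρ) →
               IsDirect (FactorSystem.dat (semFS ρ s)) × EmbClosed (semT ρ s)
    positive pos-prop (laws , _) = prop-direct laws , λ _ _ _ _ _ a≡aᵢ → a≡aᵢ
    positive (pos-base b) _ = direct b , Limit.direct⇒embClosed Φ (fs b) (lim b) (direct b)
    positive (pos-⇒ {ρ} {σ} neg pos) (s , t , laws , _) =
      FunSpace-direct A C laws (proj₁ (negative neg s)) (proj₁ (positive pos t)) ,
      FunT-embClosed A C Φ (proj₂ (negative neg s)) (proj₂ (positive pos t))
      where
      A = semFS ρ s
      C = semFS σ t

    negative : ∀ {ρ} → Neg ρ → (s : Str ρ) →
               IsInverse (FactorSystem.dat (semFS ρ s)) × ProjClosed (semT ρ s)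
    negative neg-prop (laws , _) = prop-inverse laws , λ _ _ _ _ _ a≡aᵢ' → a≡aᵢ'
    negative (neg-⇒ {ρ} {σ} pos neg) (s , t , laws , _) =
      FunSpace-inverse A C laws (proj₁ (positive pos s)) (proj₁ (negative neg t)) ,
      FunT-projClosed A C Φ (proj₂ (positive pos s)) (proj₂ (negative neg t))
      where
      A = semFS ρ s
      C = semFS σ t

lemma3p5 : {B : Set} (Φ : FilterAssignment) (𝓘 : Interp B Φ) (ρ : Ty B)
           (i i' : ∣ Interp.Index 𝓘 ρ ∣) (p : DirPreorder._≤_ (Interp.Index 𝓘 ρ) i i') →
           (Pos ρ →
             IsDirect (FactorSystem.dat (Interp.⟦_⟧fs 𝓘 ρ))
             × (∀ a (aᵢ : FactorSystem.M (Interp.⟦_⟧fs 𝓘 ρ) i) →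
                  TData.lrel (Interp.⟦_⟧ 𝓘 ρ) i a aᵢ →
                  TData.lrel (Interp.⟦_⟧ 𝓘 ρ) i' a (FactorSystem.emb (Interp.⟦_⟧fs 𝓘 ρ) p aᵢ)))
           × (Neg ρ →
             IsInverse (FactorSystem.dat (Interp.⟦_⟧fs 𝓘 ρ))
             × (∀ a (aᵢ' : FactorSystem.M (Interp.⟦_⟧fs 𝓘 ρ) i') →
                  TData.lrel (Interp.⟦_⟧ 𝓘 ρ) i' a aᵢ' →
                  TData.lrel (Interp.⟦_⟧ 𝓘 ρ) i a (FactorSystem.proj (Interp.⟦_⟧fs 𝓘 ρ) p aᵢ')))
lemma3p5 Φ 𝓘 ρ i i' p =
  (λ pos → let direct , embClosed = positive pos (str ρ) in direct , embClosed i i' p) ,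
  (λ neg → let inverse , projClosed = negative neg (str ρ) in inverse , projClosed i i' p)
  where
  open Interp 𝓘
  open Polarity Φ baseI
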